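{- Let $k\ge 1$ and $r\ge 0$ be integers. Let $\mathcal{C}$ be a collection of $2^k+r$ non-zero residues modulo $2^{k+1}$ such that no sub-collection sums to $2^k$ modulo $2^{k+1}$, and such that for no odd $\lambda$ can $\lambda\cdot\mathcal{C}$ be type 1 compressed. Then at least one of the following holds: $\mathcal{C}$ contains at least $2^{k-1}+r$ even residues; or there is an odd residue $t$ modulo $2^{k+1}$ such that $\mathcal{C}$ contains at least $2^{k-1}+r$ elements each equal to one of $t,-t,2^k-t,-(2^k-t)$; or there are three elements $x_1,x_2,x_3$ of $\mathcal{C}$ (at distinct positions) with $|\{x_1,x_2,x_3\}^*|\ge 6$.
   Context: A collection is a finite multiset of residues modulo $2^{k+1}$; a sub-collection is a sub-multiset (chosen by a set of positions). For a collection $\mathcal{D}=\{d_1,\dots,d_m\}$, its iterated sumset is the set $\mathcal{D}^*=\{\sum_{i\in I}d_i \bmod 2^{k+1}: I\subseteq\{1,\dots,m\}\}$. For an integer $\lambda$, $\lambda\cdot\mathcal{C}=\{\lambda c: c\in\mathcal{C}\}$. For a residue $t$, $|t|$ is the minimal absolute value of an integer in its residue class modulo $2^{k+1}$. A collection $\mathcal{D}$ can be type 1 compressed if there is $\lambda>0$ such that $\mathcal{D}$ contains at least $\lambda$ elements each equal to $1$ or $-1$ and also an element $t$ with $1<|t|\le\lambda+1$. -}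

module Defs where

open import Data.Nat as ℕ using (ℕ; zero; suc; _^_; _⊓_; _∸_; NonZero)
open import Data.Integer as ℤ using (ℤ; +_; -_; _-_; _+_; _*_; ∣_∣)
open import Data.Integer.DivMod using (_%ℕ_)
open import Data.Integer.Divisibility using (_∣_)
open import Data.Fin using (Fin)
open import Data.Vec using (Vec; []; _∷_; map; lookup)
open import Data.Bool using (Bool; true; false)
open import Data.Fin.Subset using (Subset)
open import Data.Product using (Σ; ∃; _×_; _,_)
open import Data.Sum using (_⊎_)
open import Relation.Nullary using (¬_)
open import Relation.Binary.PropositionalEquality using (_≡_; _≢_)
open import Function.Definitions using (Injective)

modulus : ℕ → ℕ
modulus k = 2 ^ suc k

modulus-nonZero : ∀ k → NonZero (modulus k)
modulus-nonZero k = ℕ.>-nonZero (Data.Nat.Properties.m^n>0 2 (suc k))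
  where import Data.Nat.Properties

-- Residues modulo 2^(k+1) are represented by integers; congruence mod 2^(k+1).
infix 4 _≡[_]_
_≡[_]_ : ℤ → ℕ → ℤ → Set
a ≡[ k ] b = (+ modulus k) ∣ (a - b)

absRes : ℕ → ℤ → ℕ
absRes k t = a ⊓ (modulus k ∸ a)
  where
    instance _ = modulus-nonZero k
    a = t %ℕ modulus k

subSum : ∀ {n} → Vec ℤ n → Subset n → ℤ
subSum []       []          = + 0
subSum (x ∷ xs) (true ∷ s)  = x + subSum xs s
subSum (x ∷ xs) (false ∷ s) = subSum xs s

-- The iterated sumset D* (as residues mod 2^(k+1)) has at least m elements:
-- there are m sub-collections whose sums are pairwise incongruent.
SumsetAtLeast : ℕ → (m : ℕ) → ∀ {n} → Vec ℤ n → Set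
SumsetAtLeast k m {n} D =
  Σ (Fin m → Subset n) λ g → ∀ i j → i ≢ j → ¬ (subSum D (g i) ≡[ k ] subSum D (g j))

ContainsAtLeast : (m : ℕ) → ∀ {n} → (ℤ → Set) → Vec ℤ n → Set
ContainsAtLeast m {n} P D =
  Σ (Fin m → Fin n) λ f → Injective _≡_ _≡_ f × (∀ i → P (lookup D (f i)))

Type1Compressible : ℕ → ∀ {n} → Vec ℤ n → Set
Type1Compressible k {n} D =
  Σ ℕ λ lam → (0 ℕ.< lam) ×
    ContainsAtLeast lam (λ x → (x ≡[ k ] + 1) ⊎ (x ≡[ k ] - + 1)) D ×
    Σ (Fin n) λ j → (1 ℕ.< absRes k (lookup D j)) × (absRes k (lookup D j) ℕ.≤ suc lam)

scale : ∀ {n} → ℤ → Vec ℤ n → Vec ℤ n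
scale lam = map (lam *_)

Odd : ℤ → Set
Odd x = ¬ ((+ 2) ∣ x)

Even : ℤ → Set
Even x = (+ 2) ∣ x

module Submission where

-- Lemma 3.8, modulo N = 2^(k+1) with k ≥ 1.  Two pigeonhole steps reduce it to a
-- local statement: unless 2^(k-1)+r elements are even, C has odd elements a, b at
-- distinct positions; unless 2^(k-1)+r elements are ≡ ±a, C has elements y, z at
-- distinct positions with y, z ≢ ±a.  We exhibit three elements whose subset sums take
-- six residues: (a, b, y) if y is even (likewise z), and (a, y, z) if both are odd.
-- Subset sums split by parity and sums of different parity are never congruent (N is
-- even), so it suffices to list a few pairwise incongruent even and odd sums.  The
-- incompressibility hypothesis is used once: an element e ≡ ±2a would make λ·C type 1
-- compressible for λ ≡ ±a⁻¹ (mod N), as then λa ≡ ±1 and λe ≡ 2.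

open import Defs
open import Data.Nat using (ℕ; _≤_)
open import Data.Integer using (ℤ)

module Parity where
  open import Data.Nat as ℕ using (suc; s≤s)
  import Data.Nat.Divisibility as ℕ
  import Data.Nat.Properties as ℕ
  open import Data.Integer using (+_; -_; _+_; _-_; _*_; ∣_∣)
  open import Data.Integer.Properties using (+-identityˡ; ∣-i∣≡∣i∣)
  import Data.Integer.Divisibility.Signed as ℤ
  open import Data.Integer.DivMod using (_%ℕ_; _/ℕ_; n%ℕd<d; a≡a%ℕn+[a/ℕn]*n)
  open import Data.Integer.Tactic.RingSolver using (solve)
  open import Data.List using () renaming (_∷_ to _∷ₗ_; [] to []ₗ)
  open import Data.Empty using (⊥-elim)
  open import Relation.Nullary using (Dec)
  open import Relation.Binary.PropositionalEquality using (_≡_; subst; trans; cong; module ≡-Reasoning)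
  open import Function using (_∘′_)

  even? : ∀ x → Dec (Even x)
  even? x = 2 ℕ.∣? ∣ x ∣

  even-zero : Even (+ 0)
  even-zero = 2 ℕ.∣0

  even-two : Even (+ 2)
  even-two = ℕ.∣-refl

  odd-one : Odd (+ 1)
  odd-one = ℕ.>⇒∤ (ℕ.n<1+n 1)

  odd-neg : ∀ x → Odd x → Odd (- x)
  odd-neg x ox = ox ∘′ subst (2 ℕ.∣_) (∣-i∣≡∣i∣ x)

  -- Defs uses unsigned divisibility, which hides its arguments behind ∣_∣;
  -- these two conversions pass to signed divisibility, where closure lemmas live.
  even⇒2∣ : ∀ x → Even x → + 2 ℤ.∣ x
  even⇒2∣ x = ℤ.∣ᵤ⇒∣ {+ 2} {x}

  2∣⇒even : ∀ x → + 2 ℤ.∣ x → Even x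
  2∣⇒even x = ℤ.∣⇒∣ᵤ {+ 2} {x}

  even+even : ∀ x y → Even x → Even y → Even (x + y)
  even+even x y ex ey = 2∣⇒even (x + y) (ℤ.∣m∣n⇒∣m+n (even⇒2∣ x ex) (even⇒2∣ y ey))

  odd+even : ∀ x y → Odd x → Even y → Odd (x + y)
  odd+even x y ox ey exy = ox (2∣⇒even x (ℤ.∣m+n∣n⇒∣m (even⇒2∣ (x + y) exy) (even⇒2∣ y ey)))

  even+odd : ∀ x y → Even x → Odd y → Odd (x + y)
  even+odd x y ex oy exy = oy (2∣⇒even y (ℤ.∣m+n∣m⇒∣n (even⇒2∣ (x + y) exy) (even⇒2∣ x ex)))

  even-*ʳ : ∀ x y → Even x → Even (x * y)
  even-*ʳ x y ex = 2∣⇒even (x * y) (ℤ.∣m⇒∣m*n y (even⇒2∣ x ex))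

  odd⇒even-pred : ∀ x → Odd x → Even (x - + 1)
  odd⇒even-pred x ox with x %ℕ 2 | x /ℕ 2 | n%ℕd<d x 2 | a≡a%ℕn+[a/ℕn]*n x 2
  ... | 0 | q | _ | x≡2q = ⊥-elim (ox (2∣⇒even x (ℤ.divides q (trans x≡2q (+-identityˡ (q * + 2))))))
  ... | 1 | q | _ | x≡2q+1 = 2∣⇒even (x - + 1) (ℤ.divides q (begin
    x - + 1               ≡⟨ cong (_- + 1) x≡2q+1 ⟩
    + 1 + q * + 2 - + 1   ≡⟨ solve (q ∷ₗ []ₗ) ⟩
    q * + 2               ∎))
    where open ≡-Reasoning
  ... | suc (suc _) | _ | s≤s (s≤s ()) | _

  odd+odd : ∀ x y → Odd x → Odd y → Even (x + y)
  odd+odd x y ox oy = subst Even x-1+y-1+2≡x+y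
    (even+even (x - + 1) _ (odd⇒even-pred x ox) (even+even (y - + 1) (+ 2) (odd⇒even-pred y oy) even-two))
    where
      x-1+y-1+2≡x+y : (x - + 1) + ((y - + 1) + + 2) ≡ x + y
      x-1+y-1+2≡x+y = solve (x ∷ₗ y ∷ₗ []ₗ)

module Congruence (k : ℕ) where
  open import Data.Nat as ℕ using (s≤s)
  import Data.Nat.Divisibility as ℕ
  open import Data.Integer using (+_; -_; _+_; _-_; _*_; ∣_∣)
  open import Data.Integer.Properties using (abs-*)
  import Data.Integer.Divisibility.Signed as ℤ
  open import Data.Integer.Tactic.RingSolver using (solve)
  open import Data.List using () renaming (_∷_ to _∷ₗ_; [] to []ₗ)
  open import Data.Sum using (_⊎_; inj₁; inj₂)
  open import Data.Empty using (⊥)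
  open import Relation.Nullary using (¬_; Dec)
  open import Relation.Nullary.Decidable using (map′; _⊎-dec_)
  open import Relation.Binary.PropositionalEquality using (_≡_; subst; trans; cong; sym)
  open Parity

  N : ℤ
  N = + modulus k

  -- u ≈ v is the congruence u ≡[ k ] v, stated with signed divisibility and wrapped
  -- in a record so that type inference can recover u and v.
  infix 4 _≈_ _≈±_ _≈?_ _≈±?_
  record _≈_ (u v : ℤ) : Set where
    constructor ≈-intro
    field divisible : N ℤ.∣ (u - v)

  ≡[k]⇒≈ : ∀ u v → u ≡[ k ] v → u ≈ v
  ≡[k]⇒≈ u v u≡v = ≈-intro (ℤ.∣ᵤ⇒∣ {N} {u - v} u≡v)

  ≈⇒≡[k] : ∀ {u v} → u ≈ v → u ≡[ k ] v
  ≈⇒≡[k] (≈-intro N∣u-v) = ℤ.∣⇒∣ᵤ N∣u-v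

  _≈?_ : ∀ u v → Dec (u ≈ v)
  u ≈? v = map′ (≡[k]⇒≈ u v) ≈⇒≡[k] (modulus k ℕ.∣? ∣ u - v ∣)

  _≈±_ : ℤ → ℤ → Set
  u ≈± a = u ≈ a ⊎ u ≈ - a

  _≈±?_ : ∀ u a → Dec (u ≈± a)
  u ≈±? a = (u ≈? a) ⊎-dec (u ≈? - a)

  ≈±-weaken : ∀ t u → u ≈± t →
    (u ≡[ k ] t) ⊎ (u ≡[ k ] (- t)) ⊎ (u ≡[ k ] (+ (2 ℕ.^ k) - t))
      ⊎ (u ≡[ k ] (- (+ (2 ℕ.^ k) - t)))
  ≈±-weaken _ _ (inj₁ u≈t)  = inj₁ (≈⇒≡[k] u≈t)
  ≈±-weaken _ _ (inj₂ u≈-t) = inj₂ (inj₁ (≈⇒≡[k] u≈-t))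

  ≈-combine : ∀ {u v u' v' w w'} (c c' : ℤ) → u ≈ v → u' ≈ v' →
              w - w' ≡ c * (u - v) + c' * (u' - v') → w ≈ w'
  ≈-combine c c' (≈-intro d) (≈-intro d') eq =
    ≈-intro (subst (N ℤ.∣_) (sym eq) (ℤ.∣m∣n⇒∣m+n (ℤ.∣n⇒∣m*n c d) (ℤ.∣n⇒∣m*n c' d')))

  ≈-scale : ∀ {u v w w'} (c : ℤ) → u ≈ v → w - w' ≡ c * (u - v) → w ≈ w'
  ≈-scale c (≈-intro d) eq = ≈-intro (subst (N ℤ.∣_) (sym eq) (ℤ.∣n⇒∣m*n c d))

  refute : ∀ {u v u' v' w w'} → ¬ (w ≈ w') → u ≈ v → u' ≈ v' → ∀ c c' →
           w - w' ≡ c * (u - v) + c' * (u' - v') → ⊥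
  refute w≉w' u≈v u'≈v' c c' eq = w≉w' (≈-combine c c' u≈v u'≈v' eq)

  apart : ∀ {w w'} → ¬ (w ≈ w') → ∀ c u v → w - w' ≡ c * (u - v) → ¬ (u ≈ v)
  apart w≉w' c u v eq u≈v = w≉w' (≈-scale c u≈v eq)

  ≈-refl : ∀ {u} → u ≈ u
  ≈-refl {u} = ≈-intro (ℤ.divides (+ 0) (solve (u ∷ₗ []ₗ)))

  ≉-sym : ∀ {u v} → ¬ (u ≈ v) → ¬ (v ≈ u)
  ≉-sym {u} {v} u≉v = apart u≉v (- + 1) v u (solve (u ∷ₗ v ∷ₗ []ₗ))

  even-odd-apart : ∀ u v → Even u → Odd v → ¬ (u ≈ v)
  even-odd-apart u v eu ov (≈-intro N∣u-v) = ov (2∣⇒even v (subst (+ 2 ℤ.∣_) u-[u-v]≡v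
    (ℤ.∣m∣n⇒∣m-n (even⇒2∣ u eu) (ℤ.∣-trans 2∣N N∣u-v))))
    where
      u-[u-v]≡v : u - (u - v) ≡ v
      u-[u-v]≡v = solve (u ∷ₗ v ∷ₗ []ₗ)

      2∣N : + 2 ℤ.∣ N
      2∣N = ℤ.∣ᵤ⇒∣ (ℕ.m∣m*n (2 ℕ.^ k))

  -- For k ≥ 1 the residue 2x of an odd x is nonzero: 2^(k+1) ∣ 2x would force 2^k ∣ x.
  double-odd-≉0 : 1 ≤ k → ∀ x → Odd x → ¬ (x + x ≈ + 0)
  double-odd-≉0 (s≤s _) x ox 2x≈0 = ox (ℕ.∣-trans (ℕ.m∣m*n (2 ℕ.^ ℕ.pred k))
    (ℕ.*-cancelˡ-∣ 2 (subst (modulus k ℕ.∣_) ∣2x-0∣≡2∣x∣ (≈⇒≡[k] 2x≈0))))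
    where
      2x-0≡2*x : x + x - + 0 ≡ + 2 * x
      2x-0≡2*x = solve (x ∷ₗ []ₗ)

      ∣2x-0∣≡2∣x∣ : ∣ x + x - + 0 ∣ ≡ 2 ℕ.* ∣ x ∣
      ∣2x-0∣≡2∣x∣ = trans (cong ∣_∣ 2x-0≡2*x) (abs-* (+ 2) x)

module PairwiseLookup where
  open import Data.Fin using (zero; suc)
  open import Data.List using (lookup)
  import Data.List.Relation.Unary.All as All
  open import Data.List.Relation.Unary.AllPairs using (AllPairs; _∷_)
  open import Data.List.Membership.Propositional.Properties using (∈-lookup)
  open import Data.Empty using (⊥-elim)
  open import Relation.Binary.PropositionalEquality using (refl; cong; _≢_)
  open import Function using (_∘_)

  allPairs-lookup : ∀ {A : Set} {R : A → A → Set} → (∀ {a b} → R a b → R b a) →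
                    ∀ {xs} → AllPairs R xs → ∀ i j → i ≢ j → R (lookup xs i) (lookup xs j)
  allPairs-lookup sym (_ ∷ _)   zero    zero    i≢j = ⊥-elim (i≢j refl)
  allPairs-lookup sym (Rx ∷ _)  zero    (suc j) _   = All.lookup Rx (∈-lookup j)
  allPairs-lookup sym (Rx ∷ _)  (suc i) zero    _   = sym (All.lookup Rx (∈-lookup i))
  allPairs-lookup sym (_ ∷ Rxs) (suc i) (suc j) i≢j = allPairs-lookup sym Rxs i j (i≢j ∘ cong suc)

module SubCollectionsOfTriples where
  open import Data.Integer using (+_; _+_)
  open import Data.Integer.Properties using (+-identityʳ; +-assoc)
  open import Data.Vec using (Vec; _∷_; [])
  open import Data.Bool using (true; false)
  open import Data.Fin.Subset using (Subset)
  open import Relation.Binary.PropositionalEquality using (_≡_; refl; cong; trans; sym)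

  triple : ℤ → ℤ → ℤ → Vec ℤ 3
  triple x y z = x ∷ y ∷ z ∷ []

  data Part : Set where
    ⟨⟩ ⟨1⟩ ⟨2⟩ ⟨3⟩ ⟨12⟩ ⟨13⟩ ⟨23⟩ ⟨123⟩ : Part

  positions : Part → Subset 3
  positions ⟨⟩    = false ∷ false ∷ false ∷ []
  positions ⟨1⟩   = true  ∷ false ∷ false ∷ []
  positions ⟨2⟩   = false ∷ true  ∷ false ∷ []
  positions ⟨3⟩   = false ∷ false ∷ true  ∷ []
  positions ⟨12⟩  = true  ∷ true  ∷ false ∷ []
  positions ⟨13⟩  = true  ∷ false ∷ true  ∷ []
  positions ⟨23⟩  = false ∷ true  ∷ true  ∷ []
  positions ⟨123⟩ = true  ∷ true  ∷ true  ∷ []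

  -- The sum of a sub-collection, as a plain ring expression the ring solver can read.
  sumOf : ℤ → ℤ → ℤ → Part → ℤ
  sumOf x y z ⟨⟩    = + 0
  sumOf x y z ⟨1⟩   = x
  sumOf x y z ⟨2⟩   = y
  sumOf x y z ⟨3⟩   = z
  sumOf x y z ⟨12⟩  = x + y
  sumOf x y z ⟨13⟩  = x + z
  sumOf x y z ⟨23⟩  = y + z
  sumOf x y z ⟨123⟩ = x + y + z

  subSum-positions : ∀ x y z p → subSum (triple x y z) (positions p) ≡ sumOf x y z p
  subSum-positions x y z ⟨⟩    = refl
  subSum-positions x y z ⟨1⟩   = +-identityʳ x
  subSum-positions x y z ⟨2⟩   = +-identityʳ y
  subSum-positions x y z ⟨3⟩   = +-identityʳ z
  subSum-positions x y z ⟨12⟩  = cong (λ t → x + t) (+-identityʳ y)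
  subSum-positions x y z ⟨13⟩  = cong (λ t → x + t) (+-identityʳ z)
  subSum-positions x y z ⟨23⟩  = cong (λ t → y + t) (+-identityʳ z)
  subSum-positions x y z ⟨123⟩ = trans (cong (λ t → x + (y + t)) (+-identityʳ z)) (sym (+-assoc x y z))

module DistinctSums (k : ℕ) (x y z : ℤ) where
  open import Function using (_∘_)
  open import Data.List using (List; length; lookup; _++_)
  open import Data.Product using (_,_)
  open import Data.List.Relation.Unary.All as All using (All)
  import Data.List.Relation.Unary.AllPairs.Properties as AllPairs
  open import Data.List.Relation.Unary.AllPairs using (AllPairs)
  open import Relation.Nullary using (¬_)
  open import Relation.Binary.PropositionalEquality using (subst₂; sym)
  open Parity
  open Congruence k
  open SubCollectionsOfTriples
  open PairwiseLookup

  sum : Part → ℤ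
  sum = sumOf x y z

  Apart : Part → Part → Set
  Apart p q = ¬ (sum p ≈ sum q)

  distinct-sums : (ps : List Part) → AllPairs Apart ps → SumsetAtLeast k (length ps) (triple x y z)
  distinct-sums ps pairwise-apart = positions ∘ lookup ps , λ i j i≢j →
    subst₂ (λ a b → ¬ (a ≡[ k ] b)) (sym (subSum-positions x y z (lookup ps i)))
      (sym (subSum-positions x y z (lookup ps j)))
      (allPairs-lookup ≉-sym pairwise-apart i j i≢j ∘ ≡[k]⇒≈ _ _)

  sumset-by-parity : (evens odds : List Part) →
    All (Even ∘ sum) evens → All (Odd ∘ sum) odds →
    AllPairs Apart evens → AllPairs Apart odds →
    SumsetAtLeast k (length (evens ++ odds)) (triple x y z)
  sumset-by-parity evens odds even-sums odd-sums apart-evens apart-odds =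
    distinct-sums (evens ++ odds) (AllPairs.++⁺ apart-evens apart-odds
      (All.map (λ {p} ep → All.map (λ {q} oq → even-odd-apart (sum p) (sum q) ep oq) odd-sums) even-sums))

module SixSums (k : ℕ) (k≥1 : 1 ≤ k) where
  open import Data.Integer using (+_; -_; _+_; _-_)
  open import Data.Integer.Tactic.RingSolver using (solve)
  open import Data.List using (List; []; _∷_)
  open import Data.List using () renaming (_∷_ to _∷ₗ_; [] to []ₗ)
  open import Data.List.Relation.Unary.All using ([]; _∷_)
  open import Data.List.Relation.Unary.AllPairs using ([]; _∷_)
  open import Data.Sum using (inj₁; inj₂; _⊎_)
  open import Function using (_∘_)
  open import Relation.Nullary using (¬_; yes; no)
  open import Relation.Nullary.Decidable using (_⊎-dec_)
  open Parity
  open Congruence k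
  open SubCollectionsOfTriples

  -- x, y odd and e even: the even sums 0, e, x+y, x+y+e are distinct, as are the odd x, x+e.
  four-even-sums : ∀ {x y e} → Odd x → Odd y → Even e → ¬ (e ≈ + 0) → ¬ (x + y ≈ + 0) →
                   ¬ (e ≈ x + y) → ¬ (e ≈ - (x + y)) → SumsetAtLeast k 6 (triple x y e)
  four-even-sums {x} {y} {e} ox oy ee e≉0 s≉0 e≉s e≉-s =
    sumset-by-parity (⟨⟩ ∷ ⟨3⟩ ∷ ⟨12⟩ ∷ ⟨123⟩ ∷ []) (⟨1⟩ ∷ ⟨13⟩ ∷ [])
      (even-zero ∷ ee ∷ s-even ∷ even+even (x + y) e s-even ee ∷ [])
      (ox ∷ odd+even x e ox ee ∷ [])
      ( (apart e≉0 (- + 1) (+ 0) e (solve vs) ∷ apart s≉0 (- + 1) (+ 0) (x + y) (solve vs)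
           ∷ apart e≉-s (- + 1) (+ 0) (x + y + e) (solve vs) ∷ [])
      ∷ (apart e≉s (+ 1) e (x + y) (solve vs) ∷ apart s≉0 (- + 1) e (x + y + e) (solve vs) ∷ [])
      ∷ (apart e≉0 (- + 1) (x + y) (x + y + e) (solve vs) ∷ [])
      ∷ [] ∷ [])
      ((apart e≉0 (- + 1) x (x + e) (solve vs) ∷ []) ∷ [] ∷ [])
    where
      open DistinctSums k x y e
      vs : List ℤ
      vs = x ∷ₗ y ∷ₗ e ∷ₗ []ₗ
      s-even : Even (x + y)
      s-even = odd+odd x y ox oy

  -- x, y odd and e even: the odd sums x, y, x+e, y+e are distinct, as are the even 0, e.
  four-odd-sums : ∀ {x y e} → Odd x → Odd y → Even e → ¬ (e ≈ + 0) → ¬ (x ≈ y) →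
                  ¬ (e ≈ x - y) → ¬ (e ≈ y - x) → SumsetAtLeast k 6 (triple x y e)
  four-odd-sums {x} {y} {e} ox oy ee e≉0 x≉y e≉x-y e≉y-x =
    sumset-by-parity (⟨⟩ ∷ ⟨3⟩ ∷ []) (⟨1⟩ ∷ ⟨2⟩ ∷ ⟨13⟩ ∷ ⟨23⟩ ∷ [])
      (even-zero ∷ ee ∷ [])
      (ox ∷ oy ∷ odd+even x e ox ee ∷ odd+even y e oy ee ∷ [])
      ((apart e≉0 (- + 1) (+ 0) e (solve vs) ∷ []) ∷ [] ∷ [])
      ( (x≉y ∷ apart e≉0 (- + 1) x (x + e) (solve vs) ∷ apart e≉x-y (- + 1) x (y + e) (solve vs) ∷ [])
      ∷ (apart e≉y-x (- + 1) y (x + e) (solve vs) ∷ apart e≉0 (- + 1) y (y + e) (solve vs) ∷ [])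
      ∷ (apart x≉y (+ 1) (x + e) (y + e) (solve vs) ∷ [])
      ∷ [] ∷ [])
    where
      open DistinctSums k x y e
      vs : List ℤ
      vs = x ∷ₗ y ∷ₗ e ∷ₗ []ₗ

  -- If one of the conditions of
  -- four-even-sums fails (x + y ≡ 0 or e ≡ ±(x + y)), those of four-odd-sums hold: each
  -- of their failures would force 2x or 2y ≡ 0, or e ≡ ±2x.
  mixed-triple : ∀ {x y e} → Odd x → Odd y → Even e → ¬ (e ≈ + 0) → ¬ (e ≈± x + x) →
                 SumsetAtLeast k 6 (triple x y e)
  mixed-triple {x} {y} {e} ox oy ee e≉0 e≉±2x
    with (x + y ≈? + 0) ⊎-dec (e ≈? x + y) ⊎-dec (e ≈? - (x + y))
  ... | no ¬degenerate =
    four-even-sums ox oy ee e≉0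
      (¬degenerate ∘ inj₁) (¬degenerate ∘ inj₂ ∘ inj₁) (¬degenerate ∘ inj₂ ∘ inj₂)
  ... | yes degenerate = four-odd-sums ox oy ee e≉0 (x≉y degenerate) (e≉x-y degenerate) (e≉y-x degenerate)
    where
      Degenerate : Set
      Degenerate = (x + y ≈ + 0) ⊎ (e ≈ x + y) ⊎ (e ≈ - (x + y))

      vs : List ℤ
      vs = x ∷ₗ y ∷ₗ e ∷ₗ []ₗ

      2x≉0 : ¬ (x + x ≈ + 0)
      2x≉0 = double-odd-≉0 k≥1 x ox

      2y≉0 : ¬ (y + y ≈ + 0)
      2y≉0 = double-odd-≉0 k≥1 y oy

      e≉2x : ¬ (e ≈ x + x)
      e≉2x = e≉±2x ∘ inj₁

      e≉-2x : ¬ (e ≈ - (x + x))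
      e≉-2x = e≉±2x ∘ inj₂

      x≉y : Degenerate → ¬ (x ≈ y)
      x≉y (inj₁ s≈0)         x≈y = refute 2x≉0 x≈y s≈0 (+ 1) (+ 1) (solve vs)
      x≉y (inj₂ (inj₁ e≈s))  x≈y = refute e≉2x e≈s x≈y (+ 1) (- + 1) (solve vs)
      x≉y (inj₂ (inj₂ e≈-s)) x≈y = refute e≉-2x e≈-s x≈y (+ 1) (+ 1) (solve vs)

      e≉x-y : Degenerate → ¬ (e ≈ x - y)
      e≉x-y (inj₁ s≈0)         e≈x-y = refute e≉2x e≈x-y s≈0 (+ 1) (- + 1) (solve vs)
      e≉x-y (inj₂ (inj₁ e≈s))  e≈x-y = refute 2y≉0 e≈x-y e≈s (+ 1) (- + 1) (solve vs)
      e≉x-y (inj₂ (inj₂ e≈-s)) e≈x-y = refute 2x≉0 e≈-s e≈x-y (+ 1) (- + 1) (solve vs)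

      e≉y-x : Degenerate → ¬ (e ≈ y - x)
      e≉y-x (inj₁ s≈0)         e≈y-x = refute e≉-2x e≈y-x s≈0 (+ 1) (+ 1) (solve vs)
      e≉y-x (inj₂ (inj₁ e≈s))  e≈y-x = refute 2x≉0 e≈y-x e≈s (+ 1) (- + 1) (solve vs)
      e≉y-x (inj₂ (inj₂ e≈-s)) e≈y-x = refute 2y≉0 e≈-s e≈y-x (+ 1) (- + 1) (solve vs)

  -- Three odd elements with y, z ≢ ±x and z ≢ y: even sums 0, x+y, x+z and odd sums x, y, z.
  three-odd-distinct : ∀ {x y z} → Odd x → Odd y → Odd z →
                       ¬ (y ≈± x) → ¬ (z ≈± x) → ¬ (z ≈ y) → SumsetAtLeast k 6 (triple x y z)
  three-odd-distinct {x} {y} {z} ox oy oz y≉±x z≉±x z≉y =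
    sumset-by-parity (⟨⟩ ∷ ⟨12⟩ ∷ ⟨13⟩ ∷ []) (⟨1⟩ ∷ ⟨2⟩ ∷ ⟨3⟩ ∷ [])
      (even-zero ∷ odd+odd x y ox oy ∷ odd+odd x z ox oz ∷ [])
      (ox ∷ oy ∷ oz ∷ [])
      ( (apart (y≉±x ∘ inj₂) (- + 1) (+ 0) (x + y) (solve vs)
           ∷ apart (z≉±x ∘ inj₂) (- + 1) (+ 0) (x + z) (solve vs) ∷ [])
      ∷ (apart z≉y (- + 1) (x + y) (x + z) (solve vs) ∷ [])
      ∷ [] ∷ [])
      ( (apart (y≉±x ∘ inj₁) (- + 1) x y (solve vs)
           ∷ apart (z≉±x ∘ inj₁) (- + 1) x z (solve vs) ∷ [])
      ∷ (apart z≉y (- + 1) y z (solve vs) ∷ [])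
      ∷ [] ∷ [])
    where
      open DistinctSums k x y z
      vs : List ℤ
      vs = x ∷ₗ y ∷ₗ z ∷ₗ []ₗ

  -- Three odd elements with y, z ≢ ±x and y + z ≢ 0: even sums 0, x+y, y+z and odd sums
  -- x, y, x+y+z.
  three-odd-repeated : ∀ {x y z} → Odd x → Odd y → Odd z →
                       ¬ (y ≈± x) → ¬ (z ≈± x) → ¬ (y + z ≈ + 0) → SumsetAtLeast k 6 (triple x y z)
  three-odd-repeated {x} {y} {z} ox oy oz y≉±x z≉±x y+z≉0 =
    sumset-by-parity (⟨⟩ ∷ ⟨12⟩ ∷ ⟨23⟩ ∷ []) (⟨1⟩ ∷ ⟨2⟩ ∷ ⟨123⟩ ∷ [])
      (even-zero ∷ odd+odd x y ox oy ∷ odd+odd y z oy oz ∷ [])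
      (ox ∷ oy ∷ even+odd (x + y) z (odd+odd x y ox oy) oz ∷ [])
      ( (apart (y≉±x ∘ inj₂) (- + 1) (+ 0) (x + y) (solve vs)
           ∷ apart y+z≉0 (- + 1) (+ 0) (y + z) (solve vs) ∷ [])
      ∷ (apart (z≉±x ∘ inj₁) (- + 1) (x + y) (y + z) (solve vs) ∷ [])
      ∷ [] ∷ [])
      ( (apart (y≉±x ∘ inj₁) (- + 1) x y (solve vs)
           ∷ apart y+z≉0 (- + 1) x (x + y + z) (solve vs) ∷ [])
      ∷ (apart (z≉±x ∘ inj₂) (- + 1) y (x + y + z) (solve vs) ∷ [])
      ∷ [] ∷ [])
    where
      open DistinctSums k x y z
      vs : List ℤ
      vs = x ∷ₗ y ∷ₗ z ∷ₗ []ₗ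

  -- Three odd elements x, y, z with y, z ≢ ±x.  If z ≢ y the sums are as in
  -- three-odd-distinct; if z ≡ y then y + z ≡ 2y ≢ 0 and three-odd-repeated applies.
  odd-triple : ∀ {x y z} → Odd x → Odd y → Odd z → ¬ (y ≈± x) → ¬ (z ≈± x) →
               SumsetAtLeast k 6 (triple x y z)
  odd-triple {x} {y} {z} ox oy oz y≉±x z≉±x with z ≈? y
  ... | no z≉y  = three-odd-distinct ox oy oz y≉±x z≉±x z≉y
  ... | yes z≈y = three-odd-repeated ox oy oz y≉±x z≉±x λ y+z≈0 →
    refute (double-odd-≉0 k≥1 y oy) y+z≈0 z≈y (+ 1) (- + 1) (solve (y ∷ₗ z ∷ₗ []ₗ))

module Inverse where
  open import Data.Nat as ℕ using (zero; suc; _^_)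
  import Data.Nat.Divisibility as ℕ
  open import Data.Integer using (+_; -_; _-_; _*_; ∣_∣)
  open import Data.Integer.Properties using (*-identityˡ; ∣-i∣≡∣i∣; abs-*)
  open import Data.Integer.Tactic.RingSolver using (solve)
  open import Data.List using () renaming (_∷_ to _∷ₗ_; [] to []ₗ)
  open import Data.Product using (Σ; _,_)
  open import Relation.Binary.PropositionalEquality using (_≡_; subst; sym; trans; cong)
  open Parity

  -- Newton's iteration l ↦ l(2 − la) replaces the error la − 1 by −(la − 1)², so an
  -- inverse of a modulo 2^(j+1) yields one modulo 2^(j+2).
  inverse : ∀ a → Odd a → ∀ j → Σ ℤ λ l → l * a ≡[ j ] + 1
  inverse a oa zero = + 1 , subst (λ t → Even (t - + 1)) (sym (*-identityˡ a)) (odd⇒even-pred a oa)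
  inverse a oa (suc j) with inverse a oa j
  ... | l , la≡1 = l * (+ 2 - l * a) ,
    subst (modulus (suc j) ℕ.∣_) (sym ∣new-error∣) (ℕ.*-pres-∣ (ℕ.∣-trans 2∣modulus la≡1) la≡1)
    where
      2∣modulus : 2 ℕ.∣ modulus j
      2∣modulus = ℕ.m∣m*n (2 ^ j)

      new-error : l * (+ 2 - l * a) * a - + 1 ≡ - ((l * a - + 1) * (l * a - + 1))
      new-error = solve (l ∷ₗ a ∷ₗ []ₗ)

      ∣new-error∣ : ∣ l * (+ 2 - l * a) * a - + 1 ∣ ≡ ∣ l * a - + 1 ∣ ℕ.* ∣ l * a - + 1 ∣
      ∣new-error∣ = trans (cong ∣_∣ new-error) (trans (∣-i∣≡∣i∣ (error * error)) (abs-* error error))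
        where
          error : ℤ
          error = l * a - + 1

module Compression (k : ℕ) (k≥1 : 1 ≤ k) where
  open import Data.Nat as ℕ using (suc; s≤s; z≤n; _<_; _⊓_; _∸_; _⊔_)
  import Data.Nat.Properties as ℕ
  import Data.Nat.Divisibility as ℕ
  open import Data.Nat.DivMod using (m<n⇒m%n≡m)
  open import Data.Integer using (+_; -_; _+_; _-_; _*_; ∣_∣)
  import Data.Integer.Properties as ℤ
  import Data.Integer.Divisibility.Signed as ℤ
  open import Data.Integer.DivMod using (_%ℕ_; _/ℕ_; n%ℕd<d; a≡a%ℕn+[a/ℕn]*n)
  open import Data.Integer.Tactic.RingSolver using (solve)
  open import Data.List using () renaming (_∷_ to _∷ₗ_; [] to []ₗ)
  open import Data.Vec using (Vec; lookup)
  open import Data.Vec.Properties using (lookup-map)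
  open import Data.Fin using (zero)
  open import Data.Product using (Σ; _×_; _,_)
  open import Data.Sum using (_⊎_; inj₁; inj₂; map)
  open import Data.Empty using (⊥-elim)
  open import Relation.Nullary using (¬_)
  open import Relation.Binary.PropositionalEquality using (_≡_; refl; subst; sym; trans; cong)
  open Parity
  open Congruence k
  open Inverse

  instance
    modulus≢0 : ℕ.NonZero (modulus k)
    modulus≢0 = modulus-nonZero k

  -- An odd a has an odd inverse λ modulo N (λ is odd because λa ≡ 1 and N is even).
  odd-inverse : ∀ a → Odd a → Σ ℤ λ lam → Odd lam × lam * a ≈ + 1
  odd-inverse a oa with inverse a oa k
  ... | lam , lam*a≡1 = lam , odd-lam , ≡[k]⇒≈ _ _ lam*a≡1
    where
      odd-lam : Odd lam
      odd-lam even-lam = even-odd-apart (lam * a) (+ 1) (even-*ʳ lam a even-lam) odd-one (≡[k]⇒≈ _ _ lam*a≡1)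

  small-multiple≡0 : ∀ {m n} → m ℕ.∣ n → n < m → n ≡ 0
  small-multiple≡0 {n = 0}     _   _   = refl
  small-multiple≡0 {n = suc _} m∣n n<m = ⊥-elim (ℕ.>⇒∤ n<m m∣n)

  %-cong : ∀ u v → u ≈ v → u %ℕ modulus k ≡ v %ℕ modulus k
  %-cong u v (≈-intro N∣u-v) = ℤ.+-injective (ℤ.i-j≡0⇒i≡j (+ ru) (+ rv) (ℤ.∣i∣≡0⇒i≡0
    (small-multiple≡0 (ℤ.∣⇒∣ᵤ N∣ru-rv) ∣ru-rv∣<N)))
    where
      ru rv : ℕ
      ru = u %ℕ modulus k
      rv = v %ℕ modulus k

      rearrange : ∀ {u v} R R' Q Q' n → u ≡ R + Q * n → v ≡ R' + Q' * n → R - R' ≡ (u - v) + (Q' - Q) * n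
      rearrange R R' Q Q' n refl refl = solve (R ∷ₗ R' ∷ₗ Q ∷ₗ Q' ∷ₗ n ∷ₗ []ₗ)

      N∣ru-rv : N ℤ.∣ (+ ru - + rv)
      N∣ru-rv = subst (N ℤ.∣_)
        (sym (rearrange (+ ru) (+ rv) (u /ℕ modulus k) (v /ℕ modulus k) N
          (a≡a%ℕn+[a/ℕn]*n u (modulus k)) (a≡a%ℕn+[a/ℕn]*n v (modulus k))))
        (ℤ.∣m∣n⇒∣m+n N∣u-v (ℤ.∣n⇒∣m*n (v /ℕ modulus k - u /ℕ modulus k) ℤ.∣-refl))

      ∣ru-rv∣<N : ∣ + ru - + rv ∣ < modulus k
      ∣ru-rv∣<N = ℕ.≤-<-trans
        (subst (ℕ._≤ ru ⊔ rv) (cong ∣_∣ (sym (ℤ.m-n≡m⊖n ru rv))) (ℤ.∣m⊝n∣≤m⊔n ru rv))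
        (ℕ.⊔-lub (n%ℕd<d u (modulus k)) (n%ℕd<d v (modulus k)))

  absRes-cong : ∀ u v → u ≈ v → absRes k u ≡ absRes k v
  absRes-cong u v u≈v = cong (λ r → r ⊓ (modulus k ∸ r)) (%-cong u v u≈v)

  absRes-two : absRes k (+ 2) ≡ 2
  absRes-two = trans (cong (λ r → r ⊓ (modulus k ∸ r)) (m<n⇒m%n≡m 2<N))
                     (ℕ.m≤n⇒m⊓n≡m (ℕ.∸-monoˡ-≤ 2 4≤N))
    where
      4≤modulus : ∀ j → 1 ℕ.≤ j → 4 ℕ.≤ modulus j
      4≤modulus (suc j) _ = ℕ.*-monoʳ-≤ 2 (ℕ.*-monoʳ-≤ 2 (ℕ.m^n>0 2 j))

      4≤N : 4 ℕ.≤ modulus k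
      4≤N = 4≤modulus k k≥1

      2<N : 2 < modulus k
      2<N = ℕ.≤-trans (s≤s (s≤s (s≤s z≤n))) 4≤N

  compressible : ∀ {n} (C : Vec ℤ n) lam i l → lam * lookup C i ≈± + 1 → lam * lookup C l ≈ + 2 →
                 Type1Compressible k (scale lam C)
  compressible C lam i l unit two =
    1 , s≤s z≤n , ((λ _ → i) , (λ { {zero} {zero} _ → refl }) , λ _ → unit-scaled) ,
    l , subst (1 <_) (sym |λe|≡2) (s≤s (s≤s z≤n)) , subst (ℕ._≤ 2) (sym |λe|≡2) ℕ.≤-refl
    where
      unit-scaled : (lookup (scale lam C) i ≡[ k ] + 1) ⊎ (lookup (scale lam C) i ≡[ k ] - + 1)
      unit-scaled = subst (λ t → (t ≡[ k ] + 1) ⊎ (t ≡[ k ] - + 1)) (sym (lookup-map i (lam *_) C))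
                      (map ≈⇒≡[k] ≈⇒≡[k] unit)

      |λe|≡2 : absRes k (lookup (scale lam C) l) ≡ 2
      |λe|≡2 = trans (cong (absRes k) (lookup-map l (lam *_) C)) (trans (absRes-cong _ (+ 2) two) absRes-two)

  -- For an odd element a of an incompressible C, no element e is ≡ ±2a: with λ the
  -- inverse of a, either λ or −λ compresses C.
  no-double : ∀ {n} (C : Vec ℤ n) → (∀ lam → Odd lam → ¬ Type1Compressible k (scale lam C)) →
              ∀ i l → Odd (lookup C i) → ¬ (lookup C l ≈± lookup C i + lookup C i)
  no-double C incompressible i l oa e≈±2a with odd-inverse (lookup C i) oa | e≈±2a
  ... | lam , odd-lam , λa≈1 | inj₁ e≈2a = incompressible lam odd-lam
    (compressible C lam i l (inj₁ λa≈1)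
      (≈-combine lam (+ 2) e≈2a λa≈1 (λe-2 lam (lookup C l) (lookup C i))))
    where
      λe-2 : ∀ lam e a → lam * e - + 2 ≡ lam * (e - (a + a)) + + 2 * (lam * a - + 1)
      λe-2 lam e a = solve (lam ∷ₗ e ∷ₗ a ∷ₗ []ₗ)
  ... | lam , odd-lam , λa≈1 | inj₂ e≈-2a = incompressible (- lam) (odd-neg lam odd-lam)
    (compressible C (- lam) i l (inj₂ (≈-scale (- + 1) λa≈1 (-λa+1 lam (lookup C i))))
      (≈-combine (- lam) (+ 2) e≈-2a λa≈1 (-λe-2 lam (lookup C l) (lookup C i))))
    where
      -λa+1 : ∀ lam a → - lam * a - - + 1 ≡ - + 1 * (lam * a - + 1)
      -λa+1 lam a = solve (lam ∷ₗ a ∷ₗ []ₗ)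

      -λe-2 : ∀ lam e a → - lam * e - + 2 ≡ - lam * (e - - (a + a)) + + 2 * (lam * a - + 1)
      -λe-2 lam e a = solve (lam ∷ₗ e ∷ₗ a ∷ₗ []ₗ)

module Counting where
  open import Data.Nat as ℕ using (suc; _<_; s≤s)
  import Data.Nat.Properties as ℕ
  open import Data.Fin using (Fin; punchIn; inject≤)
  import Data.Fin.Properties as Fin
  open import Data.Vec using (Vec; lookup)
  open import Data.Product using (Σ; _×_; _,_)
  open import Data.Sum using (_⊎_; inj₁; inj₂)
  open import Relation.Nullary using (¬_; Dec; yes; no)
  open import Relation.Binary.PropositionalEquality using (_≢_; sym)
  open import Function using (_∘_)

  contains-mono : ∀ {n m} {P Q : ℤ → Set} (D : Vec ℤ n) → (∀ x → P x → Q x) →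
                  ContainsAtLeast m P D → ContainsAtLeast m Q D
  contains-mono D P⇒Q (f , f-injective , P-f) = f , f-injective , λ i → P⇒Q (lookup D (f i)) (P-f i)

  at-least-or-two-exceptions : ∀ {n} m {P : ℤ → Set} → (∀ x → Dec (P x)) → (D : Vec ℤ n) → m < n →
    ContainsAtLeast m P D ⊎
    Σ (Fin n) λ i → Σ (Fin n) λ j → i ≢ j × ¬ P (lookup D i) × ¬ P (lookup D j)
  at-least-or-two-exceptions {suc n} m P? D (s≤s m≤n) with Fin.all? (P? ∘ lookup D)
  ... | yes all = inj₁ ((λ t → inject≤ t (ℕ.m≤n⇒m≤1+n m≤n)) ,
                       (λ {s} {t} → Fin.inject≤-injective _ _ s t) , λ t → all _)
  ... | no ¬all with Fin.¬∀⟶∃¬ (suc n) _ (P? ∘ lookup D) ¬all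
  ...   | i , ¬Pi with Fin.all? (P? ∘ lookup D ∘ punchIn i)
  ...     | yes others = inj₁ ((λ t → punchIn i (inject≤ t m≤n)) ,
                 (λ {s} {t} eq → Fin.inject≤-injective _ _ s t (Fin.punchIn-injective i _ _ eq)) ,
                 λ t → others _)
  ...     | no ¬others with Fin.¬∀⟶∃¬ n _ (P? ∘ lookup D ∘ punchIn i) ¬others
  ...       | j , ¬Pj = inj₂ (i , punchIn i j , (λ eq → Fin.punchInᵢ≢i i j (sym eq)) , ¬Pi , ¬Pj)

-- From here on _+_ is addition of natural numbers and lookup is lookup in vectors.
open import Data.Nat using (_+_; _^_; _∸_)
import Data.Nat as ℕ
import Data.Nat.Properties as ℕ
open import Data.Integer using (+_; -_; _-_)
open import Data.Vec using (Vec; lookup; _∷_; [])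
open import Data.Fin using (Fin)
open import Data.Fin.Subset using (Subset)
open import Data.Product using (Σ; _×_; _,_)
open import Data.Sum using (_⊎_; inj₁; inj₂)
open import Relation.Nullary using (¬_)
open import Relation.Binary.PropositionalEquality using (_≢_)
open import Function using (case_of_; _∘_)

module FindTriple (k : ℕ) (k≥1 : 1 ≤ k) {n : ℕ} (C : Vec ℤ n)
         (nonzero : ∀ i → ¬ (lookup C i ≡[ k ] + 0))
         (incompressible : ∀ (lam : ℤ) → Odd lam → ¬ Type1Compressible k (scale lam C)) where
  open import Relation.Nullary using (yes; no)
  open import Relation.Binary.PropositionalEquality using (refl)
  open Parity
  open Congruence k
  open SixSums k k≥1
  open Compression k k≥1

  SixSumTriple : Set
  SixSumTriple = Σ (Fin n) λ i → Σ (Fin n) λ j → Σ (Fin n) λ l →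
                 i ≢ j × i ≢ l × j ≢ l × SumsetAtLeast k 6 (lookup C i ∷ lookup C j ∷ lookup C l ∷ [])

  apart-from : ∀ {i j} → ¬ (lookup C j ≈± lookup C i) → i ≢ j
  apart-from j≉±a refl = j≉±a (inj₁ ≈-refl)

  odd-even-apart : ∀ {i j} → Odd (lookup C i) → Even (lookup C j) → i ≢ j
  odd-even-apart odd-i even-j refl = odd-i even-j

  -- Two odd elements and an even one: e ≢ 0 by hypothesis and e ≢ ±2a by incompressibility.
  mixed : ∀ {i₀ i₁ j} → Odd (lookup C i₀) → Odd (lookup C i₁) → Even (lookup C j) →
          SumsetAtLeast k 6 (lookup C i₀ ∷ lookup C i₁ ∷ lookup C j ∷ [])
  mixed {i₀} {i₁} {j} odd₀ odd₁ even-j =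
    mixed-triple odd₀ odd₁ even-j (nonzero j ∘ ≈⇒≡[k]) (no-double C incompressible i₀ j odd₀)

  -- If y or z is even, take (a, b, y) or (a, b, z); otherwise (a, y, z) consists of odd elements.
  find-triple : ∀ {i₀ i₁ j l} → i₀ ≢ i₁ → Odd (lookup C i₀) → Odd (lookup C i₁) → j ≢ l →
                ¬ (lookup C j ≈± lookup C i₀) → ¬ (lookup C l ≈± lookup C i₀) → SixSumTriple
  find-triple {i₀} {i₁} {j} {l} i₀≢i₁ odd₀ odd₁ j≢l j≉±a l≉±a
    with even? (lookup C j) | even? (lookup C l)
  ... | yes even-j | _ =
    i₀ , i₁ , j , i₀≢i₁ , apart-from j≉±a , odd-even-apart odd₁ even-j , mixed odd₀ odd₁ even-j
  ... | no _ | yes even-l =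
    i₀ , i₁ , l , i₀≢i₁ , apart-from l≉±a , odd-even-apart odd₁ even-l , mixed odd₀ odd₁ even-l
  ... | no odd-j | no odd-l =
    i₀ , j , l , apart-from j≉±a , apart-from l≉±a , j≢l , odd-triple odd₀ odd-j odd-l j≉±a l≉±a

half<whole : ∀ k r → 1 ≤ k → 2 ^ (k ∸ 1) + r ℕ.< 2 ^ k + r
half<whole (ℕ.suc k) r _ = ℕ.+-monoˡ-< r (ℕ.m<m+n (2 ^ k) 0<2^k+0)
  where
    0<2^k+0 : 0 ℕ.< 2 ^ k + 0
    0<2^k+0 = ℕ.<-≤-trans (ℕ.m^n>0 2 k) (ℕ.m≤m+n (2 ^ k) 0)

lemma3p8 : (k r : ℕ) → 1 ≤ k → (C : Vec ℤ (2 ^ k + r))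
    → (∀ i → ¬ (lookup C i ≡[ k ] + 0))
    → (∀ (S : Subset (2 ^ k + r)) → ¬ (subSum C S ≡[ k ] + (2 ^ k)))
    → (∀ (lam : ℤ) → Odd lam → ¬ Type1Compressible k (scale lam C))
    → ContainsAtLeast (2 ^ (k ∸ 1) + r) Even C
      ⊎ (Σ ℤ λ t → Odd t × ContainsAtLeast (2 ^ (k ∸ 1) + r)
           (λ x → (x ≡[ k ] t) ⊎ (x ≡[ k ] (- t)) ⊎ (x ≡[ k ] (+ (2 ^ k) - t))
                  ⊎ (x ≡[ k ] (- (+ (2 ^ k) - t)))) C)
      ⊎ (Σ (Fin (2 ^ k + r)) λ i → Σ (Fin (2 ^ k + r)) λ j → Σ (Fin (2 ^ k + r)) λ l →
           i ≢ j × i ≢ l × j ≢ l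
           × SumsetAtLeast k 6 (lookup C i ∷ lookup C j ∷ lookup C l ∷ []))
lemma3p8 k r k≥1 C nonzero _ incompressible =
  let open Congruence k
      open FindTriple k k≥1 C nonzero incompressible
  in case at-least-or-two-exceptions M even? C M<n of λ where
    (inj₁ many-even) → inj₁ many-even
    (inj₂ (i₀ , i₁ , i₀≢i₁ , odd₀ , odd₁)) →
      case at-least-or-two-exceptions M (_≈±? lookup C i₀) C M<n of λ where
        (inj₁ many-±a) →
          inj₂ (inj₁ (lookup C i₀ , odd₀ , contains-mono C (≈±-weaken (lookup C i₀)) many-±a))
        (inj₂ (j , l , j≢l , j≉±a , l≉±a)) →
          inj₂ (inj₂ (find-triple i₀≢i₁ odd₀ odd₁ j≢l j≉±a l≉±a))
  where
    open Parity using (even?)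
    open Counting using (at-least-or-two-exceptions; contains-mono)
    M : ℕ
    M = 2 ^ (k ∸ 1) + r

    M<n : M ℕ.< 2 ^ k + r
    M<n = half<whole k r k≥1
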